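{- Let $N\ge0$, $k\ge1$, $X=\{0,\ldots,N\}^k$, and let $f$ be a feasibility function on $X$. In a run of $\textsc{ParetoEnumerate}$ on $f$, for each iteration of the main loop let $D(S)=\{\vec z\in X:\ \vec z\leq_k\vec y \text{ for some }\vec y\in S\}$. Then $D(S)$ after the iteration is a proper subset of $D(S)$ before the iteration; that is, this set only shrinks and it loses at least one point per iteration.
   Context: $X$ is ordered componentwise: $\vec x\leq_k\vec x'$ iff $x_i\le x'_i$ for all $i$. A feasibility function is a monotone $f:X\to\{\mathbf{true},\mathbf{false}\}$ (if $f(\vec x)=\mathbf{true}$ and $\vec x\leq_k\vec x'$ then $f(\vec x')=\mathbf{true}$). A Pareto point is $\vec x$ with $f(\vec x)=\mathbf{true}$ and $f(\vec x')=\mathbf{false}$ for all $\vec x'\ne\vec x$ with $\vec x'\leq_k\vec x$. $\textsc{SearchParetoPoint}(\vec x)$: for $i=1,\ldots,k$: $\mathit{max}\gets x_i+1$, $\mathit{min}\gets0$; while $\mathit{max}-\mathit{min}>1$: $\mathit{mid}\gets\mathit{min}+\lfloor(\mathit{max}-\mathit{min}-1)/2\rfloor$, $x_i\gets\mathit{mid}$, if $f(\vec x)=\mathbf{true}$ then $\mathit{max}\gets\mathit{mid}+1$ else $\mathit{min}\gets\mathit{mid}+1$; then $x_i\gets\mathit{min}$. Return $\vec x$. $\textsc{RemoveDominatingElements}(S')$ returns the set of those $\vec x\in S'$ for which there is no $\vec y\in S'$ with $\vec x\leq_k\vec y$ and $\vec x\neq\vec y$. $\textsc{ParetoEnumerate}$: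 initialize $S\gets\{(N,\ldots,N)\}$, $P\gets\emptyset$. Main loop: while $S\neq\emptyset$: pick (without removing) some $\vec x\in S$; if $f(\vec x)=\mathbf{true}$ then: $\vec x\gets\textsc{SearchParetoPoint}(\vec x)$; $P\gets P\cup\{\vec x\}$; $S'\gets\emptyset$; for each $\vec y\in S$: if not $\vec x\leq_k\vec y$, add $\vec y$ to $S'$; otherwise, for each $i\in\{1,\ldots,k\}$ with $x_i>0$ add $(y_1,\ldots,y_{i-1},x_i-1,y_{i+1},\ldots,y_k)$ to $S'$; then $S\gets\textsc{RemoveDominatingElements}(S')$. Otherwise set $S\gets S\setminus\{\vec x\}$. When the loop ends, return $P$. -}

module Defs where

open import Data.Nat using (ℕ; zero; suc; _+_; _∸_; _≤_; _<_; _≤?_; _<?_; ⌊_/2⌋)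
open import Data.Nat.Properties using () renaming (_≟_ to _≟ℕ_)
open import Data.Bool using (Bool; true; false; if_then_else_; not; _∧_)
open import Data.Fin using (Fin)
open import Data.Vec using (Vec; replicate; lookup; _[_]≔_)
open import Data.Vec.Properties using (≡-dec)
open import Data.Vec.Relation.Unary.All using (All)
open import Data.Vec.Relation.Binary.Pointwise.Inductive as PW using (Pointwise)
open import Data.List using (List; []; _∷_; [_]; concatMap; filter; foldl; allFin)
open import Data.Bool.ListAction using (any)
open import Data.List.Membership.Propositional using (_∈_)
open import Data.List.Relation.Unary.Any using (Any)
open import Data.Product using (Σ; _×_; _,_; ∃)
open import Relation.Nullary using (¬_; does)
open import Relation.Binary.PropositionalEquality using (_≡_)

Point : ℕ → Set
Point k = Vec ℕ k

InX : ∀ {k} → ℕ → Point k → Set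
InX N x = All (_≤ N) x

_≤ₖ_ : ∀ {k} → Point k → Point k → Set
x ≤ₖ y = Pointwise _≤_ x y

_≤ₖ?_ : ∀ {k} → (x y : Point k) → Bool
x ≤ₖ? y = does (PW.decidable _≤?_ x y)

_≟ₖ_ : ∀ {k} → (x y : Point k) → Bool
x ≟ₖ y = does (≡-dec _≟ℕ_ x y)

-- feasibility function on X (given as a function on ℕ^k; only its values on X matter)
Feasibility : (N k : ℕ) → (Point k → Bool) → Set
Feasibility N k f = ∀ (x x' : Point k) → InX N x → InX N x' → x ≤ₖ x' →
                    f x ≡ true → f x' ≡ true

module Algorithm {k : ℕ} (N : ℕ) (f : Point k → Bool) where

  -- the while loop of the binary search on coordinate i; returns the final 'min'.
  -- 'fuel' bounds the number of iterations; it is started with max ∸ min, which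
  -- suffices since max ∸ min strictly decreases in every iteration.
  bsearch : (fuel : ℕ) → Point k → Fin k → (mn mx : ℕ) → ℕ
  bsearch zero x i mn mx = mn
  bsearch (suc fuel) x i mn mx with does (suc mn <? mx)
  ... | false = mn
  ... | true  =
    let mid = mn + ⌊ mx ∸ mn ∸ 1 /2⌋ in
    if f (x [ i ]≔ mid)
      then bsearch fuel x i mn (suc mid)
      else bsearch fuel x i (suc mid) mx

  searchCoord : Point k → Fin k → Point k
  searchCoord x i = x [ i ]≔ bsearch (suc (lookup x i)) x i 0 (suc (lookup x i))

  searchParetoPoint : Point k → Point k
  searchParetoPoint x = foldl searchCoord x (allFin k)

  removeDominatingElements : List (Point k) → List (Point k)
  removeDominatingElements S' =
    filter (λ x → not (any (λ y → (x ≤ₖ? y) ∧ not (x ≟ₖ y)) S') Data.Bool.≟ true) S'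

  splitS : Point k → List (Point k) → List (Point k)
  splitS x S = removeDominatingElements (concatMap replace S)
    where
    replace : Point k → List (Point k)
    replace y with x ≤ₖ? y
    ... | false = [ y ]
    ... | true  = concatMap (λ i → if does (0 <? lookup x i)
                                     then [ y [ i ]≔ (lookup x i ∸ 1) ]
                                     else []) (allFin k)

  removePoint : Point k → List (Point k) → List (Point k)
  removePoint x = filter (λ y → not (y ≟ₖ x) Data.Bool.≟ true)

  -- one iteration of the main loop, from state (S , P) to state (S' , P');
  -- 'x ∈ S' is the nondeterministic choice (and implies S ≠ ∅)
  data Step : List (Point k) × List (Point k) → List (Point k) × List (Point k) → Set where
    step-true  : ∀ {S P x} → x ∈ S → f x ≡ true →
                 Step (S , P) (splitS (searchParetoPoint x) S , searchParetoPoint x ∷ P)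
    step-false : ∀ {S P x} → x ∈ S → f x ≡ false →
                 Step (S , P) (removePoint x S , P)

  initial : List (Point k) × List (Point k)
  initial = (replicate k N ∷ []) , []

  data Reachable : List (Point k) × List (Point k) → Set where
    start : Reachable initial
    next  : ∀ {σ τ} → Reachable σ → Step σ τ → Reachable τ

  D : List (Point k) → Point k → Set
  D S z = InX N z × Any (z ≤ₖ_) S

_⊂_ : ∀ {k} → (Point k → Set) → (Point k → Set) → Set
A ⊂ B = (∀ z → A z → B z) × ∃ λ z → B z × ¬ A z

module Submission where

-- Every iteration of the main loop replaces S by a list S' that is covered by
-- S (S' ≼ S: each element of S' lies below an element of S), hence
-- D(S') ⊆ D(S).  For properness we exhibit a point of
-- D(S) that is below no element of S':
--   * if f(x) = true, the Pareto point p = SearchParetoPoint(x) satisfies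
--     p ≤ₖ x (binary search only lowers coordinates), and every new element of
--     S' avoids p: it is either an old y with ¬ p ≤ₖ y, or y with coordinate i
--     set to pᵢ - 1 < pᵢ;
--   * if f(x) = false, the point x itself, since the states reached by the
--     algorithm are antichains (RemoveDominatingElements produces one), so x is
--     below no element of S ∖ {x}.

open import Defs
open import Data.Nat using (ℕ; _≤_)
open import Data.Bool using (Bool)
open import Data.List using (List)
open import Data.Product using (_×_; _,_)

open import Data.Nat using (zero; suc; _+_; _∸_; _<_; _<ᵇ_; _≤?_; _<?_; ⌊_/2⌋; z≤n; s≤s)
open import Data.Nat.Properties
  using (⌊n/2⌋<n; ∸-monoʳ-<; ≤-trans; ≤-refl; <-irrefl; m≤m+n; <⇒≤; ≤-pred; <ᵇ⇒<)
  renaming (_≟_ to _≟ℕ_)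
open import Data.Bool using (T; true; false; not; _∧_; if_then_else_)
open import Data.Bool.Properties using (T-≡)
open import Data.Fin using (Fin)
open import Data.Vec using ([]; _∷_; lookup; _[_]≔_; replicate)
open import Data.Vec.Properties using (≡-dec; lookup∘update)
open import Data.Vec.Relation.Unary.All using ([]; _∷_)
open import Data.Vec.Relation.Binary.Pointwise.Inductive as PW using ([]; _∷_)
open import Data.List using ([]; _∷_; [_]; foldl; concatMap; allFin)
open import Data.List.Membership.Propositional using (_∈_; find; lose)
open import Data.List.Membership.Propositional.Properties using (∈-filter⁻; ∈-concatMap⁻)
open import Data.List.Relation.Unary.Any using (Any; here) renaming (map to Any-map)
open import Data.List.Relation.Unary.Any.Properties using (any⁺)
open import Data.Product using (proj₁; proj₂)
open import Function.Bundles using (Equivalence)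
open import Relation.Nullary using (¬_; does; Dec; yes; no; contradiction)
open import Relation.Nullary.Decidable using (dec-true; dec-false)
open import Relation.Binary.PropositionalEquality using (_≡_; _≢_; refl; sym; subst; cong; cong₂)

not-does⇒¬ : ∀ {P : Set} (d : Dec P) → not (does d) ≡ true → ¬ P
not-does⇒¬ (yes _) ()
not-does⇒¬ (no ¬p) _ = ¬p

not-true⇒¬T : ∀ {b} → not b ≡ true → ¬ T b
not-true⇒¬T {true} ()
not-true⇒¬T {false} _ ()

∈-if-singleton : ∀ {A : Set} {P : Set} (d : Dec P) {v w : A} →
                 w ∈ (if does d then [ v ] else []) → P × w ≡ v
∈-if-singleton (yes p) (here w≡v) = p , w≡v
∈-if-singleton (no _) ()

≤ₖ-refl : ∀ {k} (x : Point k) → x ≤ₖ x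
≤ₖ-refl x = PW.refl ≤-refl

≤ₖ-trans : ∀ {k} {x y z : Point k} → x ≤ₖ y → y ≤ₖ z → x ≤ₖ z
≤ₖ-trans = PW.trans ≤-trans

InX-≤ₖ : ∀ {k N} {x y : Point k} → x ≤ₖ y → InX N y → InX N x
InX-≤ₖ [] [] = []
InX-≤ₖ (xᵢ≤yᵢ ∷ x≤y) (yᵢ≤N ∷ y∈X) = ≤-trans xᵢ≤yᵢ yᵢ≤N ∷ InX-≤ₖ x≤y y∈X

top∈X : ∀ k N → InX N (replicate k N)
top∈X zero N = []
top∈X (suc k) N = ≤-refl ∷ top∈X k N

update-≤ₖ : ∀ {k} (y : Point k) i v → v ≤ lookup y i → (y [ i ]≔ v) ≤ₖ y
update-≤ₖ (y ∷ ys) Fin.zero v v≤y = v≤y ∷ ≤ₖ-refl ys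
update-≤ₖ (y ∷ ys) (Fin.suc i) v v≤y = ≤-refl ∷ update-≤ₖ ys i v v≤y

¬≤ₖ-update : ∀ {k} (x y : Point k) i v → v < lookup x i → ¬ x ≤ₖ (y [ i ]≔ v)
¬≤ₖ-update x y i v v<xᵢ x≤y' =
  <-irrefl refl (≤-trans v<xᵢ (subst (lookup x i ≤_) (lookup∘update i y v) (PW.lookup x≤y' i)))

foldl-≤ₖ : ∀ {k} {A : Set} (g : Point k → A → Point k) → (∀ x a → g x a ≤ₖ x) →
           ∀ (as : List A) x → foldl g x as ≤ₖ x
foldl-≤ₖ g g≤ [] x = ≤ₖ-refl x
foldl-≤ₖ g g≤ (a ∷ as) x = ≤ₖ-trans (foldl-≤ₖ g g≤ as (g x a)) (g≤ x a)

_≼_ : ∀ {k} → List (Point k) → List (Point k) → Set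
S' ≼ S = ∀ {w} → w ∈ S' → Any (w ≤ₖ_) S

⊆⇒≼ : ∀ {k} {S' S : List (Point k)} → (∀ {w} → w ∈ S' → w ∈ S) → S' ≼ S
⊆⇒≼ S'⊆S {w} w∈S' = lose (S'⊆S w∈S') (≤ₖ-refl w)

≼-below : ∀ {k} {S' S : List (Point k)} {z} → S' ≼ S → Any (z ≤ₖ_) S' → Any (z ≤ₖ_) S
≼-below S'≼S z≼S' with find z≼S'
... | w , w∈S' , z≤w = Any-map (≤ₖ-trans z≤w) (S'≼S w∈S')

≼-inside : ∀ {k N} {S' S : List (Point k)} → S' ≼ S →
           (∀ {a} → a ∈ S → InX N a) → ∀ {a} → a ∈ S' → InX N a
≼-inside S'≼S S⊆X a∈S' with find (S'≼S a∈S')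
... | y , y∈S , a≤y = InX-≤ₖ a≤y (S⊆X y∈S)

Antichain : ∀ {k} → List (Point k) → Set
Antichain S = ∀ {a b} → a ∈ S → b ∈ S → a ≤ₖ b → a ≡ b

-- While min + 1 < max, the midpoint chosen by the loop satisfies mid + 1 < max,
-- so both branches keep min < max.
midpoint< : ∀ mn mx → suc mn < mx → suc (mn + ⌊ mx ∸ mn ∸ 1 /2⌋) < mx
midpoint< zero (suc zero) (s≤s ())
midpoint< zero (suc (suc e)) _ = s≤s (⌊n/2⌋<n e)
midpoint< (suc mn) (suc mx) (s≤s lt) = s≤s (midpoint< mn mx lt)

module _ {k : ℕ} (N : ℕ) (f : Point k → Bool) where
  open Algorithm N f

  -- The loop keeps min < max, so its result is below the initial max.
  bsearch< : ∀ fuel x i mn mx → mn < mx → bsearch fuel x i mn mx < mx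
  bsearch< zero x i mn mx mn<mx = mn<mx
  bsearch< (suc fuel) x i mn mx mn<mx with suc mn <ᵇ mx in loop
  ... | false = mn<mx
  ... | true with midpoint< mn mx (<ᵇ⇒< (suc mn) mx (subst T (sym loop) _))
  ...   | mid<mx with f (x [ i ]≔ (mn + ⌊ mx ∸ mn ∸ 1 /2⌋))
  ...     | true  = ≤-trans (bsearch< fuel x i mn _ (s≤s (m≤m+n mn _))) (<⇒≤ mid<mx)
  ...     | false = bsearch< fuel x i _ mx mid<mx

  searchParetoPoint-≤ₖ : ∀ x → searchParetoPoint x ≤ₖ x
  searchParetoPoint-≤ₖ = foldl-≤ₖ searchCoord searchCoord-≤ₖ (allFin k)
    where
    searchCoord-≤ₖ : ∀ x i → searchCoord x i ≤ₖ x
    searchCoord-≤ₖ x i = update-≤ₖ x i _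
      (≤-pred (bsearch< (suc (lookup x i)) x i 0 (suc (lookup x i)) (s≤s z≤n)))

  splitS-elem : ∀ p S {w} → w ∈ splitS p S → Any (w ≤ₖ_) S × ¬ p ≤ₖ w
  splitS-elem p S w∈ with find (∈-concatMap⁻ _ {xs = S} (proj₁ (∈-filter⁻ _ {xs = concatMap _ S} w∈)))
  ... | y , y∈S , w∈replace with PW.decidable _≤?_ p y
  ...   | no p≰y with w∈replace
  ...     | here refl = lose y∈S (≤ₖ-refl y) , p≰y
  splitS-elem p S w∈ | y , y∈S , w∈replace | yes p≤y
    with find (∈-concatMap⁻ _ {xs = allFin k} w∈replace)
  ... | i , _ , w∈lowered with ∈-if-singleton (0 <? lookup p i) w∈lowered
  ... | 0<pᵢ , refl = lose y∈S (update-≤ₖ y i _ pᵢ-1≤yᵢ) , ¬≤ₖ-update p y i _ pᵢ-1<pᵢ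
    where
    pᵢ-1<pᵢ : lookup p i ∸ 1 < lookup p i
    pᵢ-1<pᵢ = ∸-monoʳ-< (s≤s z≤n) 0<pᵢ
    pᵢ-1≤yᵢ : lookup p i ∸ 1 ≤ lookup y i
    pᵢ-1≤yᵢ = ≤-trans (<⇒≤ pᵢ-1<pᵢ) (PW.lookup p≤y i)

  removeDominatingElements-antichain : ∀ L → Antichain (removeDominatingElements L)
  removeDominatingElements-antichain L {a} {b} a∈ b∈ a≤b with ≡-dec _≟ℕ_ a b
  ... | yes a≡b = a≡b
  ... | no a≢b = contradiction (any⁺ dominates (lose b∈L (Equivalence.from T-≡ dominates-b)))
                               (not-true⇒¬T (proj₂ (∈-filter⁻ _ {xs = L} a∈)))
    where
    dominates : Point k → Bool
    dominates y = (a ≤ₖ? y) ∧ not (a ≟ₖ y)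
    b∈L : b ∈ L
    b∈L = proj₁ (∈-filter⁻ _ {xs = L} b∈)
    dominates-b : dominates b ≡ true
    dominates-b = cong₂ _∧_ (dec-true (PW.decidable _≤?_ a b) a≤b)
                            (cong not (dec-false (≡-dec _≟ℕ_ a b) a≢b))

  removePoint-elem : ∀ x S {w} → w ∈ removePoint x S → w ∈ S × w ≢ x
  removePoint-elem x S w∈ with ∈-filter⁻ _ {xs = S} w∈
  ... | w∈S , keep = w∈S , not-does⇒¬ (≡-dec _≟ℕ_ _ x) keep

  step-≼ : ∀ {σ τ} → Step σ τ → proj₁ τ ≼ proj₁ σ
  step-≼ (step-true {S} {x = x} _ _) w∈ = proj₁ (splitS-elem (searchParetoPoint x) S w∈)
  step-≼ (step-false {S} {x = x} _ _) = ⊆⇒≼ (λ w∈ → proj₁ (removePoint-elem x S w∈))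

  record Invariant (S : List (Point k)) : Set where
    field
      inside    : ∀ {a} → a ∈ S → InX N a
      antichain : Antichain S
  open Invariant

  reachable-invariant : ∀ {σ} → Reachable σ → Invariant (proj₁ σ)
  reachable-invariant start = record
    { inside    = λ { (here refl) → top∈X k N }
    ; antichain = λ { (here refl) (here refl) _ → refl }
    }
  reachable-invariant (next {σ} r st) = record
    { inside    = ≼-inside (step-≼ st) (inside I)
    ; antichain = antichain-step st (antichain I)
    }
    where
    I : Invariant (proj₁ σ)
    I = reachable-invariant r
    antichain-step : ∀ {σ τ} → Step σ τ → Antichain (proj₁ σ) → Antichain (proj₁ τ)
    antichain-step (step-true {S} _ _) _ =
      removeDominatingElements-antichain (concatMap _ S)
    antichain-step (step-false {S} {x = x} _ _) A a∈ b∈ =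
      A (proj₁ (removePoint-elem x S a∈)) (proj₁ (removePoint-elem x S b∈))

  D-shrinks : ∀ {S' S : List (Point k)} {z} → S' ≼ S →
              InX N z → Any (z ≤ₖ_) S → (∀ {w} → w ∈ S' → ¬ z ≤ₖ w) → D S' ⊂ D S
  D-shrinks S'≼S z∈X z≼S z-avoids =
    (λ _ (y∈X , y≼S') → y∈X , ≼-below S'≼S y≼S') ,
    _ , (z∈X , z≼S) , λ (_ , z≼S') → let (w , w∈S' , z≤w) = find z≼S' in z-avoids w∈S' z≤w

lemma3 : (N k : ℕ) → 1 ≤ k → (f : Point k → Bool) → Feasibility N k f →
    let open Algorithm N f in
    ∀ (S P S' P' : List (Point k)) →
    Reachable (S , P) → Step (S , P) (S' , P') → D S' ⊂ D S
lemma3 N k _ f _ S P _ _ r st@(Algorithm.step-true {x = x} x∈S _) =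
  -- the Pareto point p ≤ₖ x is in D(S) but below nothing of the new S
  D-shrinks N f (step-≼ N f st) (InX-≤ₖ p≤x (Invariant.inside I x∈S)) (lose x∈S p≤x)
            (λ w∈ → proj₂ (splitS-elem N f p S w∈))
  where
  open Algorithm N f
  I : Invariant N f S
  I = reachable-invariant N f r
  p : Point k
  p = searchParetoPoint x
  p≤x : p ≤ₖ x
  p≤x = searchParetoPoint-≤ₖ N f x
lemma3 N k _ f _ S P _ _ r st@(Algorithm.step-false {x = x} x∈S _) =
  -- x is in D(S) but, S being an antichain, below nothing of S ∖ {x}
  D-shrinks N f (step-≼ N f st) (Invariant.inside I x∈S) (lose x∈S (≤ₖ-refl x)) x-avoids
  where
  open Algorithm N f
  I : Invariant N f S
  I = reachable-invariant N f r
  x-avoids : ∀ {w} → w ∈ removePoint x S → ¬ x ≤ₖ w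
  x-avoids w∈ x≤w with removePoint-elem N f x S w∈
  ... | w∈S , w≢x = w≢x (sym (Invariant.antichain I x∈S w∈S x≤w))
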